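{- Let $L$ be a $\lambda$-theory with associated Lawvere theory $\mathbf L$, and let $\mathcal D$ be a category with all colimits. Precomposition with the embedding $\mathbf M(L_1)\hookrightarrow\mathbf L$ gives an equivalence between the functor categories $[\mathbf L,\mathcal D]$ and $[\mathbf M(L_1),\mathcal D]$.
   Context: An algebraic theory $T$: sets $T_n$ ($n\in\mathbb N$), elements $x_{n,i}\in T_n$ ($1\le i\le n$), substitutions $\bullet:T_m\times T_n^m\to T_n$ with $x_j\bullet g=g_j$, $f\bullet(x_{l,i})_i=f$, $(f\bullet g)\bullet h=f\bullet(g_i\bullet h)_i$. Weakening $\iota_{m,n}(f)=f\bullet(x_{m+n,1},\dots,x_{m+n,m})$. A $\lambda$-theory is an algebraic theory $L$ with $\lambda_n:L_{n+1}\to L_n$, $\rho_n:L_n\to L_{n+1}$ such that $\lambda_m(f)\bullet h=\lambda_n(f\bullet(\iota_{n,1}(h_1),\dots,\iota_{n,1}(h_m),x_{n+1,n+1}))$ and $\rho_n(g\bullet h)=\rho_m(g)\bullet(\iota_{n,1}(h_1),\dots,\iota_{n,1}(h_m),x_{n+1,n+1})$ for $f\in L_{m+1},g\in L_m,h\in L_n^m$, and $\rho_n\circ\lambda_n=\mathrm{id}_{L_{n+1}}$. The Lawvere theory $\mathbf L$ of $L$ is the category with objects the natural numbers, $\mathbf L(m,n)=L_m^n$, identity $(x_{n,i})_i$ and composition $g\circ f=(g_i\bullet f)_i$. $L_1$ denotes the monoid $(L_1,\bullet,x_{1,1})$, and $\mathbf M(L_1)$ the one-object category with endomorphism monoid $L_1$;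 the embedding $\mathbf M(L_1)\hookrightarrow\mathbf L$ sends the unique object to $1$ and $f\in L_1$ to $f\in\mathbf L(1,1)=L_1$. $[\mathcal A,\mathcal D]$ denotes the category of functors $\mathcal A\to\mathcal D$ and natural transformations. -}

module Defs where

open import Level using (Level; _⊔_; 0ℓ) renaming (suc to lsuc)
open import Data.Nat using (ℕ; _+_)
open import Data.Fin using (Fin; zero; suc; _↑ˡ_; _↑ʳ_)
open import Data.Vec using (Vec; []; _∷_; lookup; tabulate; map; _++_)
open import Data.Vec.Properties using (map-id; map-cong; map-∘; tabulate∘lookup; tabulate-cong; tabulate-∘)
open import Data.Unit using (⊤; tt)
open import Data.Product using (Σ; _×_; _,_)
open import Relation.Binary using (Rel; IsEquivalence)
open import Relation.Binary.PropositionalEquality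
  using (_≡_; refl; sym; trans; cong; isEquivalence)

module E = IsEquivalence

-- Algebraic theories and λ-theories
-- Tuples in T_n^m are vectors  Vec (T n) m ; the variable x_{n,i}
-- (1 ≤ i ≤ n) is  var i  with  i : Fin n  (0-indexed).

record AlgebraicTheory : Set₁ where
  infixl 20 _•_
  field
    T     : ℕ → Set
    var   : ∀ {n} → Fin n → T n
    _•_   : ∀ {m n} → T m → Vec (T n) m → T n
    var-• : ∀ {m n} (j : Fin m) (g : Vec (T n) m) → var j • g ≡ lookup g j
    •-var : ∀ {m} (f : T m) → f • tabulate var ≡ f
    •-assoc : ∀ {m n l} (f : T m) (g : Vec (T n) m) (h : Vec (T l) n) →
              (f • g) • h ≡ f • map (λ gi → gi • h) g

  ι : ∀ m n → T m → T (m + n)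
  ι m n f = f • tabulate (λ i → var (i ↑ˡ n))

  ext : ∀ {m n} → Vec (T n) m → Vec (T (n + 1)) (m + 1)
  ext {m} {n} h = map (ι n 1) h ++ (var (n ↑ʳ zero) ∷ [])

record LambdaTheory : Set₁ where
  field
    theory : AlgebraicTheory
  open AlgebraicTheory theory public
  field
    lam : ∀ {n} → T (n + 1) → T n
    rho : ∀ {n} → T n → T (n + 1)
    lam-subst : ∀ {m n} (f : T (m + 1)) (h : Vec (T n) m) →
                lam f • h ≡ lam (f • ext h)
    rho-subst : ∀ {m n} (g : T m) (h : Vec (T n) m) →
                rho (g • h) ≡ rho g • ext h
    rho-lam : ∀ {n} (f : T (n + 1)) → rho (lam f) ≡ f

record Category (o ℓ e : Level) : Set (lsuc (o ⊔ ℓ ⊔ e)) where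
  infix  4 _≈_
  infixr 9 _∘_
  field
    Obj : Set o
    _⇒_ : Obj → Obj → Set ℓ
    _≈_ : ∀ {A B} → Rel (A ⇒ B) e
    id  : ∀ {A} → A ⇒ A
    _∘_ : ∀ {A B C} → B ⇒ C → A ⇒ B → A ⇒ C
    equiv     : ∀ {A B} → IsEquivalence (_≈_ {A} {B})
    assoc     : ∀ {A B C D} {f : A ⇒ B} {g : B ⇒ C} {h : C ⇒ D} →
                (h ∘ g) ∘ f ≈ h ∘ (g ∘ f)
    identityˡ : ∀ {A B} {f : A ⇒ B} → id ∘ f ≈ f
    identityʳ : ∀ {A B} {f : A ⇒ B} → f ∘ id ≈ f
    ∘-resp-≈  : ∀ {A B C} {f h : B ⇒ C} {g i : A ⇒ B} →
                f ≈ h → g ≈ i → f ∘ g ≈ h ∘ i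

record Functor {o ℓ e o′ ℓ′ e′ : Level}
               (C : Category o ℓ e) (D : Category o′ ℓ′ e′)
               : Set (o ⊔ ℓ ⊔ e ⊔ o′ ⊔ ℓ′ ⊔ e′) where
  private
    module C = Category C
    module D = Category D
  field
    F₀ : C.Obj → D.Obj
    F₁ : ∀ {A B} → A C.⇒ B → F₀ A D.⇒ F₀ B
    identity     : ∀ {A} → F₁ (C.id {A}) D.≈ D.id
    homomorphism : ∀ {X Y Z} {f : X C.⇒ Y} {g : Y C.⇒ Z} →
                   F₁ (g C.∘ f) D.≈ F₁ g D.∘ F₁ f
    F-resp-≈     : ∀ {A B} {f g : A C.⇒ B} → f C.≈ g → F₁ f D.≈ F₁ g

record NaturalTransformation {o ℓ e o′ ℓ′ e′ : Level}
       {C : Category o ℓ e} {D : Category o′ ℓ′ e′}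
       (F G : Functor C D) : Set (o ⊔ ℓ ⊔ e ⊔ o′ ⊔ ℓ′ ⊔ e′) where
  private
    module C = Category C
    module D = Category D
    module F = Functor F
    module G = Functor G
  field
    η       : ∀ X → F.F₀ X D.⇒ G.F₀ X
    commute : ∀ {X Y} (f : X C.⇒ Y) → η Y D.∘ F.F₁ f D.≈ G.F₁ f D.∘ η X

module _ {o ℓ e : Level} (C : Category o ℓ e) where
  open Category C

  record Iso (A B : Obj) : Set (ℓ ⊔ e) where
    field
      from : A ⇒ B
      to   : B ⇒ A
      isoˡ : to ∘ from ≈ id
      isoʳ : from ∘ to ≈ id

  record Cocone {o′ ℓ′ e′ : Level} {J : Category o′ ℓ′ e′} (F : Functor J C)
                : Set (o ⊔ ℓ ⊔ e ⊔ o′ ⊔ ℓ′) where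
    private module J = Category J
    open Functor F
    field
      apex : Obj
      ψ    : ∀ j → F₀ j ⇒ apex
      commute : ∀ {j j′} (f : j J.⇒ j′) → ψ j′ ∘ F₁ f ≈ ψ j

  record Colimit {o′ ℓ′ e′ : Level} {J : Category o′ ℓ′ e′} (F : Functor J C)
                 : Set (o ⊔ ℓ ⊔ e ⊔ o′ ⊔ ℓ′) where
    field
      colim : Cocone F
    open Cocone colim public
    field
      rep     : (K : Cocone F) → apex ⇒ Cocone.apex K
      factors : (K : Cocone F) → ∀ j → rep K ∘ ψ j ≈ Cocone.ψ K j
      unique  : (K : Cocone F) (u : apex ⇒ Cocone.apex K) →
                (∀ j → u ∘ ψ j ≈ Cocone.ψ K j) → u ≈ rep K

  -- "C has all (small) colimits": every diagram indexed by a small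
  -- category (objects, homs and hom-equalities in Set = Set₀) has a colimit
  Cocomplete : Set (lsuc 0ℓ ⊔ o ⊔ ℓ ⊔ e)
  Cocomplete = (J : Category 0ℓ 0ℓ 0ℓ) (F : Functor J C) → Colimit F

module _ {o ℓ e : Level} {C : Category o ℓ e} where
  open Category C

  idF : Functor C C
  idF = record
    { F₀ = λ A → A ; F₁ = λ f → f
    ; identity = E.refl equiv ; homomorphism = E.refl equiv
    ; F-resp-≈ = λ p → p }

module _ {o₁ ℓ₁ e₁ o₂ ℓ₂ e₂ o₃ ℓ₃ e₃ : Level}
         {A : Category o₁ ℓ₁ e₁} {B : Category o₂ ℓ₂ e₂} {C : Category o₃ ℓ₃ e₃} where
  private
    module C = Category C

  _∘F_ : Functor B C → Functor A B → Functor A C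
  G ∘F F = record
    { F₀ = λ X → G.F₀ (F.F₀ X)
    ; F₁ = λ f → G.F₁ (F.F₁ f)
    ; identity = E.trans C.equiv (G.F-resp-≈ F.identity) G.identity
    ; homomorphism = E.trans C.equiv (G.F-resp-≈ F.homomorphism) G.homomorphism
    ; F-resp-≈ = λ p → G.F-resp-≈ (F.F-resp-≈ p) }
    where
      module F = Functor F
      module G = Functor G

FunctorCategory : {o ℓ e o′ ℓ′ e′ : Level} →
                  Category o ℓ e → Category o′ ℓ′ e′ →
                  Category (o ⊔ ℓ ⊔ e ⊔ o′ ⊔ ℓ′ ⊔ e′) (o ⊔ ℓ ⊔ e ⊔ o′ ⊔ ℓ′ ⊔ e′) (o ⊔ e′)
FunctorCategory C D = record
  { Obj = Functor C D
  ; _⇒_ = NaturalTransformation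
  ; _≈_ = λ α β → ∀ X → NaturalTransformation.η α X D.≈ NaturalTransformation.η β X
  ; id  = λ {F} → record
      { η = λ X → D.id
      ; commute = λ f → E.trans D.equiv D.identityˡ (E.sym D.equiv D.identityʳ) }
  ; _∘_ = λ {F} {G} {H} β α → record
      { η = λ X → NaturalTransformation.η β X D.∘ NaturalTransformation.η α X
      ; commute = λ f → comp-commute β α f }
  ; equiv = record
      { refl  = λ X → E.refl D.equiv
      ; sym   = λ p X → E.sym D.equiv (p X)
      ; trans = λ p q X → E.trans D.equiv (p X) (q X) }
  ; assoc     = λ X → D.assoc
  ; identityˡ = λ X → D.identityˡ
  ; identityʳ = λ X → D.identityʳ
  ; ∘-resp-≈  = λ p q X → D.∘-resp-≈ (p X) (q X)
  }
  where
    module C = Category C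
    module D = Category D
    comp-commute : ∀ {F G H : Functor C D}
                   (β : NaturalTransformation G H) (α : NaturalTransformation F G)
                   {X Y} (f : X C.⇒ Y) →
                   (NaturalTransformation.η β Y D.∘ NaturalTransformation.η α Y)
                     D.∘ Functor.F₁ F f
                   D.≈ Functor.F₁ H f D.∘
                     (NaturalTransformation.η β X D.∘ NaturalTransformation.η α X)
    comp-commute {F} {G} {H} β α {X} {Y} f =
      E.trans D.equiv D.assoc
      (E.trans D.equiv (D.∘-resp-≈ (E.refl D.equiv) (α.commute f))
      (E.trans D.equiv (E.sym D.equiv D.assoc)
      (E.trans D.equiv (D.∘-resp-≈ (β.commute f) (E.refl D.equiv))
      D.assoc)))
      where
        module α = NaturalTransformation α
        module β = NaturalTransformation β

precompose : {o₁ ℓ₁ e₁ o₂ ℓ₂ e₂ o ℓ e : Level}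
             {A : Category o₁ ℓ₁ e₁} {B : Category o₂ ℓ₂ e₂} (D : Category o ℓ e) →
             Functor A B → Functor (FunctorCategory B D) (FunctorCategory A D)
precompose {A = A} D J = record
  { F₀ = λ F → F ∘F J
  ; F₁ = λ α → record
      { η = λ X → NaturalTransformation.η α (Functor.F₀ J X)
      ; commute = λ f → NaturalTransformation.commute α (Functor.F₁ J f) }
  ; identity = λ X → E.refl D.equiv
  ; homomorphism = λ X → E.refl D.equiv
  ; F-resp-≈ = λ p X → p (Functor.F₀ J X)
  }
  where
    module D = Category D

IsEquivalenceOfCategories : {o ℓ e o′ ℓ′ e′ : Level}
  {C : Category o ℓ e} {D : Category o′ ℓ′ e′} → Functor C D →
  Set (o ⊔ ℓ ⊔ e ⊔ o′ ⊔ ℓ′ ⊔ e′)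
IsEquivalenceOfCategories {C = C} {D = D} F =
  Σ (Functor D C) λ G →
    Iso (FunctorCategory C C) (G ∘F F) idF ×
    Iso (FunctorCategory D D) (F ∘F G) idF

module _ (Λ : LambdaTheory) where
  open LambdaTheory Λ

  private
    lid : ∀ {n} → Vec (T n) n
    lid = tabulate var

    lcomp : ∀ {m n p} → Vec (T n) p → Vec (T m) n → Vec (T m) p
    lcomp g f = map (λ gi → gi • f) g

    lidˡ : ∀ {m n} (f : Vec (T m) n) → lcomp lid f ≡ f
    lidˡ f = trans (sym (tabulate-∘ (λ gi → gi • f) var))
             (trans (tabulate-cong (λ i → var-• i f)) (tabulate∘lookup f))

    lidʳ : ∀ {m n} (f : Vec (T m) n) → lcomp f lid ≡ f
    lidʳ f = trans (map-cong •-var f) (map-id f)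

    lassoc : ∀ {a b c d} (f : Vec (T a) b) (g : Vec (T b) c) (h : Vec (T c) d) →
             lcomp (lcomp h g) f ≡ lcomp h (lcomp g f)
    lassoc f g h = trans (sym (map-∘ (λ x → x • f) (λ x → x • g) h))
                         (map-cong (λ x → •-assoc x g f) h)

  Lawvere : Category 0ℓ 0ℓ 0ℓ
  Lawvere = record
    { Obj = ℕ
    ; _⇒_ = λ m n → Vec (T m) n
    ; _≈_ = _≡_
    ; id  = lid
    ; _∘_ = lcomp
    ; equiv = isEquivalence
    ; assoc = λ {_} {_} {_} {_} {f} {g} {h} → lassoc f g h
    ; identityˡ = λ {_} {_} {f} → lidˡ f
    ; identityʳ = λ {_} {_} {f} → lidʳ f
    ; ∘-resp-≈ = λ { refl refl → refl }
    }

  MonoidCat : Category 0ℓ 0ℓ 0ℓ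
  MonoidCat = record
    { Obj = ⊤
    ; _⇒_ = λ _ _ → T 1
    ; _≈_ = _≡_
    ; id  = var zero
    ; _∘_ = λ g f → g • (f ∷ [])
    ; equiv = isEquivalence
    ; assoc = λ {_} {_} {_} {_} {f} {g} {h} → •-assoc h (g ∷ []) (f ∷ [])
    ; identityˡ = λ {_} {_} {f} → var-• zero (f ∷ [])
    ; identityʳ = λ {_} {_} {f} → •-var f
    ; ∘-resp-≈ = λ { refl refl → refl }
    }

  embedding : Functor MonoidCat Lawvere
  embedding = record
    { F₀ = λ _ → 1
    ; F₁ = λ f → f ∷ []
    ; identity = refl
    ; homomorphism = refl
    ; F-resp-≈ = λ { refl → refl }
    }

{-# OPTIONS --safe #-}
module Submission where

open import Level using (Level; _⊔_; 0ℓ)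
open import Data.Bool using (Bool; true; false; _∨_)
open import Data.Bool.Properties using (∨-assoc; ∨-identityʳ)
open import Data.Fin using (Fin; zero; suc; _↑ˡ_; _↑ʳ_)
open import Data.Nat using (ℕ; zero; suc; _+_)
open import Data.Product using (Σ-syntax; _,_; proj₁; proj₂)
open import Data.Unit using (⊤; tt)
open import Data.Vec using (Vec; []; _∷_; lookup; tabulate; map; _++_)
open import Data.Vec.Properties
  using ( map-id; map-cong; map-∘; map-++; tabulate∘lookup; tabulate-cong; tabulate-∘
        ; lookup-++ˡ; lookup-++ʳ; lookup∘tabulate )
open import Relation.Binary using (Setoid)
open import Relation.Binary.PropositionalEquality
  using (_≡_; refl; sym; trans; cong; cong₂; isEquivalence; module ≡-Reasoning)
open import Defs

-- In a λ-theory every object n of 𝐋 is a retract of 1: Church pairing ⟨a, b⟩ = λz. z a b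
-- codes an n-tuple of terms as a single term, and the projections decode it.  So the embedding
-- J : 𝐌(L₁) ↪ 𝐋 is fully faithful and every object of 𝐋 is a retract of an object in its image.
-- For such a J, precomposition is an equivalence once idempotents split in 𝒟, which they do
-- when 𝒟 is cocomplete (split ε by the colimit of the diagram generated by ε).  The inverse
-- sends F to the functor whose value at b splits the idempotent F(J⁻¹(s ∘ r)), where r ∘ s = id
-- exhibits b as a retract of some J a; a morphism f acts through F(J⁻¹(s′ ∘ f ∘ r)).  Both round
-- trips are isomorphic to the identity because two splittings of one idempotent are
-- canonically isomorphic.

module HomReasoning {o ℓ e : Level} (C : Category o ℓ e) where
  open Category C public

  hom-setoid : Obj → Obj → Setoid ℓ e
  hom-setoid A B = record { Carrier = A ⇒ B ; _≈_ = _≈_ ; isEquivalence = equiv }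

  module _ {A B : Obj} where
    open import Relation.Binary.Reasoning.Setoid (hom-setoid A B) public
    open Setoid (hom-setoid A B) public
      using () renaming (refl to ≈-refl; sym to ≈-sym; trans to ≈-trans)

  private variable
    U V W : Obj

  infixr 4 _⟩∘⟨_ refl⟩∘⟨_
  infixl 5 _⟩∘⟨refl

  _⟩∘⟨_ : {f h : V ⇒ W} {g i : U ⇒ V} → f ≈ h → g ≈ i → f ∘ g ≈ h ∘ i
  _⟩∘⟨_ = ∘-resp-≈

  refl⟩∘⟨_ : {f : V ⇒ W} {g i : U ⇒ V} → g ≈ i → f ∘ g ≈ f ∘ i
  refl⟩∘⟨ p = ∘-resp-≈ ≈-refl p

  _⟩∘⟨refl : {f h : V ⇒ W} {g : U ⇒ V} → f ≈ h → f ∘ g ≈ h ∘ g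
  p ⟩∘⟨refl = ∘-resp-≈ p ≈-refl

  sym-assoc : ∀ {T} {f : U ⇒ V} {g : V ⇒ W} {h : W ⇒ T} → h ∘ (g ∘ f) ≈ (h ∘ g) ∘ f
  sym-assoc = ≈-sym assoc

module _ {o ℓ e : Level} (C : Category o ℓ e) where
  open HomReasoning C

  record Retract (X Y : Obj) : Set (ℓ ⊔ e) where
    field
      section    : X ⇒ Y
      retract    : Y ⇒ X
      is-retract : retract ∘ section ≈ id

  record Splitting (X : Obj) {Y : Obj} (ε : Y ⇒ Y) : Set (ℓ ⊔ e) where
    field
      retraction : Retract X Y
    open Retract retraction public
    field
      splits : section ∘ retract ≈ ε

  IdempotentsSplit : Set (o ⊔ ℓ ⊔ e)
  IdempotentsSplit = ∀ {Y} (ε : Y ⇒ Y) → ε ∘ ε ≈ ε → Σ[ X ∈ Obj ] Splitting X ε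

module _ {o ℓ e : Level} {C : Category o ℓ e} where
  open HomReasoning C
  open Splitting

  private variable
    X X′ X″ Y Y′ Y″ Z Z′ : Obj

  conjugate : Retract C X Y → Retract C X′ Y′ → X ⇒ X′ → Y ⇒ Y′
  conjugate ρ ρ′ f = Retract.section ρ′ ∘ f ∘ Retract.retract ρ

  module _ (ρ : Retract C X Y) (ρ′ : Retract C X′ Y′) where
    open Retract

    conjugate-resp-≈ : {f g : X ⇒ X′} → f ≈ g → conjugate ρ ρ′ f ≈ conjugate ρ ρ′ g
    conjugate-resp-≈ f≈g = refl⟩∘⟨ f≈g ⟩∘⟨refl

    conjugate-∘ : (ρ″ : Retract C X″ Y″) (f : X ⇒ X′) (g : X′ ⇒ X″) →
                  conjugate ρ′ ρ″ g ∘ conjugate ρ ρ′ f ≈ conjugate ρ ρ″ (g ∘ f)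
    conjugate-∘ ρ″ f g = begin
      (section ρ″ ∘ g ∘ retract ρ′) ∘ section ρ′ ∘ f ∘ retract ρ ≈⟨ assoc ⟩
      section ρ″ ∘ (g ∘ retract ρ′) ∘ section ρ′ ∘ f ∘ retract ρ ≈⟨ refl⟩∘⟨ assoc ⟩
      section ρ″ ∘ g ∘ retract ρ′ ∘ section ρ′ ∘ f ∘ retract ρ   ≈⟨ refl⟩∘⟨ refl⟩∘⟨ sym-assoc ⟩
      section ρ″ ∘ g ∘ (retract ρ′ ∘ section ρ′) ∘ f ∘ retract ρ ≈⟨ refl⟩∘⟨ refl⟩∘⟨ is-retract ρ′ ⟩∘⟨refl ⟩
      section ρ″ ∘ g ∘ id ∘ f ∘ retract ρ                        ≈⟨ refl⟩∘⟨ refl⟩∘⟨ identityˡ ⟩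
      section ρ″ ∘ g ∘ f ∘ retract ρ                             ≈⟨ refl⟩∘⟨ sym-assoc ⟩
      section ρ″ ∘ (g ∘ f) ∘ retract ρ                           ∎

    retract-conjugate : (f : X ⇒ X′) → retract ρ′ ∘ conjugate ρ ρ′ f ∘ section ρ ≈ f
    retract-conjugate f = begin
      retract ρ′ ∘ (section ρ′ ∘ f ∘ retract ρ) ∘ section ρ ≈⟨ sym-assoc ⟩
      (retract ρ′ ∘ section ρ′ ∘ f ∘ retract ρ) ∘ section ρ ≈⟨ sym-assoc ⟩∘⟨refl ⟩
      ((retract ρ′ ∘ section ρ′) ∘ f ∘ retract ρ) ∘ section ρ ≈⟨ (is-retract ρ′ ⟩∘⟨refl) ⟩∘⟨refl ⟩
      (id ∘ f ∘ retract ρ) ∘ section ρ                     ≈⟨ identityˡ ⟩∘⟨refl ⟩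
      (f ∘ retract ρ) ∘ section ρ                          ≈⟨ assoc ⟩
      f ∘ retract ρ ∘ section ρ                            ≈⟨ refl⟩∘⟨ is-retract ρ ⟩
      f ∘ id                                               ≈⟨ identityʳ ⟩
      f                                                    ∎

  conjugate-id : (ρ : Retract C X Y) →
                 conjugate ρ ρ id ≈ Retract.section ρ ∘ Retract.retract ρ
  conjugate-id ρ = refl⟩∘⟨ identityˡ

  restrict : {ε : Y ⇒ Y} {ε′ : Y′ ⇒ Y′} → Splitting C X ε → Splitting C X′ ε′ → Y ⇒ Y′ → X ⇒ X′
  restrict σ σ′ f = retract σ′ ∘ f ∘ section σ

  module _ {ε : Y ⇒ Y} {ε′ : Y′ ⇒ Y′} (σ : Splitting C X ε) (σ′ : Splitting C X′ ε′) where

    restrict-resp-≈ : {f g : Y ⇒ Y′} → f ≈ g → restrict σ σ′ f ≈ restrict σ σ′ g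
    restrict-resp-≈ f≈g = refl⟩∘⟨ f≈g ⟩∘⟨refl

    restrict-absorbʳ : (f : Y ⇒ Y′) → restrict σ σ′ (f ∘ ε) ≈ restrict σ σ′ f
    restrict-absorbʳ f = refl⟩∘⟨ (begin
      (f ∘ ε) ∘ section σ                       ≈⟨ assoc ⟩
      f ∘ ε ∘ section σ                         ≈⟨ refl⟩∘⟨ ≈-sym (splits σ) ⟩∘⟨refl ⟩
      f ∘ (section σ ∘ retract σ) ∘ section σ   ≈⟨ refl⟩∘⟨ assoc ⟩
      f ∘ section σ ∘ retract σ ∘ section σ     ≈⟨ refl⟩∘⟨ refl⟩∘⟨ is-retract σ ⟩
      f ∘ section σ ∘ id                        ≈⟨ refl⟩∘⟨ identityʳ ⟩
      f ∘ section σ                             ∎)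

    restrict-absorbˡ : (f : Y ⇒ Y′) → restrict σ σ′ (ε′ ∘ f) ≈ restrict σ σ′ f
    restrict-absorbˡ f = begin
      retract σ′ ∘ (ε′ ∘ f) ∘ section σ                        ≈⟨ refl⟩∘⟨ assoc ⟩
      retract σ′ ∘ ε′ ∘ f ∘ section σ                          ≈⟨ refl⟩∘⟨ ≈-sym (splits σ′) ⟩∘⟨refl ⟩
      retract σ′ ∘ (section σ′ ∘ retract σ′) ∘ f ∘ section σ   ≈⟨ sym-assoc ⟩
      (retract σ′ ∘ section σ′ ∘ retract σ′) ∘ f ∘ section σ   ≈⟨ sym-assoc ⟩∘⟨refl ⟩
      ((retract σ′ ∘ section σ′) ∘ retract σ′) ∘ f ∘ section σ ≈⟨ (is-retract σ′ ⟩∘⟨refl) ⟩∘⟨refl ⟩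
      (id ∘ retract σ′) ∘ f ∘ section σ                        ≈⟨ identityˡ ⟩∘⟨refl ⟩
      retract σ′ ∘ f ∘ section σ                               ∎

  restrict-id : {ε : Y ⇒ Y} (σ : Splitting C X ε) → restrict σ σ id ≈ id
  restrict-id σ = ≈-trans (refl⟩∘⟨ identityˡ) (is-retract σ)

  restrict-idempotent : {ε : Y ⇒ Y} (σ : Splitting C X ε) → restrict σ σ ε ≈ id
  restrict-idempotent {ε = ε} σ = begin
    restrict σ σ ε        ≈⟨ restrict-resp-≈ σ σ (≈-sym identityʳ) ⟩
    restrict σ σ (ε ∘ id) ≈⟨ restrict-absorbˡ σ σ id ⟩
    restrict σ σ id       ≈⟨ restrict-id σ ⟩
    id                    ∎

  restrict-∘ : {ε : Y ⇒ Y} {ε′ : Y′ ⇒ Y′} {ε″ : Y″ ⇒ Y″}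
               (σ : Splitting C X ε) (σ′ : Splitting C X′ ε′) (σ″ : Splitting C X″ ε″) (f : Y ⇒ Y′) (g : Y′ ⇒ Y″) →
               restrict σ′ σ″ g ∘ restrict σ σ′ f ≈ restrict σ σ″ (g ∘ ε′ ∘ f)
  restrict-∘ {ε′ = ε′} σ σ′ σ″ f g = begin
    (retract σ″ ∘ g ∘ section σ′) ∘ retract σ′ ∘ f ∘ section σ   ≈⟨ assoc ⟩
    retract σ″ ∘ (g ∘ section σ′) ∘ retract σ′ ∘ f ∘ section σ   ≈⟨ refl⟩∘⟨ assoc ⟩
    retract σ″ ∘ g ∘ section σ′ ∘ retract σ′ ∘ f ∘ section σ     ≈⟨ refl⟩∘⟨ refl⟩∘⟨ sym-assoc ⟩
    retract σ″ ∘ g ∘ (section σ′ ∘ retract σ′) ∘ f ∘ section σ   ≈⟨ refl⟩∘⟨ refl⟩∘⟨ splits σ′ ⟩∘⟨refl ⟩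
    retract σ″ ∘ g ∘ ε′ ∘ f ∘ section σ                         ≈⟨ refl⟩∘⟨ refl⟩∘⟨ sym-assoc ⟩
    retract σ″ ∘ g ∘ (ε′ ∘ f) ∘ section σ                       ≈⟨ refl⟩∘⟨ sym-assoc ⟩
    retract σ″ ∘ (g ∘ ε′ ∘ f) ∘ section σ                       ∎

  splitting-iso : {ε : Y ⇒ Y} → Splitting C X ε → Splitting C X′ ε → Iso C X X′
  splitting-iso {ε = ε} σ σ′ = record
    { from = restrict σ σ′ id
    ; to   = restrict σ′ σ id
    ; isoˡ = round-trip σ σ′
    ; isoʳ = round-trip σ′ σ
    }
    where
      round-trip : ∀ {X X′} (σ : Splitting C X ε) (σ′ : Splitting C X′ ε) →
                   restrict σ′ σ id ∘ restrict σ σ′ id ≈ id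
      round-trip σ σ′ = begin
        restrict σ′ σ id ∘ restrict σ σ′ id ≈⟨ restrict-∘ σ σ′ σ id id ⟩
        restrict σ σ (id ∘ ε ∘ id)          ≈⟨ restrict-resp-≈ σ σ (≈-trans identityˡ identityʳ) ⟩
        restrict σ σ ε                      ≈⟨ restrict-idempotent σ ⟩
        id                                  ∎

  restrict-square : {ε : Y ⇒ Y} {ε′ : Y′ ⇒ Y′}
                    (σ : Splitting C X ε) (τ : Splitting C Z ε)
                    (σ′ : Splitting C X′ ε′) (τ′ : Splitting C Z′ ε′) (f : Y ⇒ Y′) →
                    restrict σ′ τ′ id ∘ restrict σ σ′ f ≈ restrict τ τ′ f ∘ restrict σ τ id
  restrict-square {ε = ε} {ε′} σ τ σ′ τ′ f = begin
    restrict σ′ τ′ id ∘ restrict σ σ′ f ≈⟨ restrict-∘ σ σ′ τ′ f id ⟩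
    restrict σ τ′ (id ∘ ε′ ∘ f)         ≈⟨ restrict-resp-≈ σ τ′ identityˡ ⟩
    restrict σ τ′ (ε′ ∘ f)              ≈⟨ restrict-absorbˡ σ τ′ f ⟩
    restrict σ τ′ f                     ≈⟨ ≈-sym (restrict-absorbʳ σ τ′ f) ⟩
    restrict σ τ′ (f ∘ ε)               ≈⟨ restrict-resp-≈ σ τ′ (refl⟩∘⟨ ≈-sym identityʳ) ⟩
    restrict σ τ′ (f ∘ ε ∘ id)          ≈⟨ ≈-sym (restrict-∘ σ τ τ′ id f) ⟩
    restrict τ τ′ f ∘ restrict σ τ id   ∎

  iso-square-inverse : (φ : Iso C X X′) (ψ : Iso C Y Y′) {g : X ⇒ Y} {h : X′ ⇒ Y′} →
                       Iso.from ψ ∘ g ≈ h ∘ Iso.from φ → Iso.to ψ ∘ h ≈ g ∘ Iso.to φ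
  iso-square-inverse φ ψ {g} {h} square = begin
    to ψ ∘ h                        ≈⟨ refl⟩∘⟨ ≈-sym identityʳ ⟩
    to ψ ∘ h ∘ id                   ≈⟨ refl⟩∘⟨ refl⟩∘⟨ ≈-sym (isoʳ φ) ⟩
    to ψ ∘ h ∘ from φ ∘ to φ        ≈⟨ refl⟩∘⟨ sym-assoc ⟩
    to ψ ∘ (h ∘ from φ) ∘ to φ      ≈⟨ refl⟩∘⟨ ≈-sym square ⟩∘⟨refl ⟩
    to ψ ∘ (from ψ ∘ g) ∘ to φ      ≈⟨ refl⟩∘⟨ assoc ⟩
    to ψ ∘ from ψ ∘ g ∘ to φ        ≈⟨ sym-assoc ⟩
    (to ψ ∘ from ψ) ∘ g ∘ to φ      ≈⟨ isoˡ ψ ⟩∘⟨refl ⟩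
    id ∘ g ∘ to φ                   ≈⟨ identityˡ ⟩
    g ∘ to φ                        ∎
    where open Iso

module _ {o ℓ e o′ ℓ′ e′ : Level} {C : Category o ℓ e} {D : Category o′ ℓ′ e′} where
  private
    module C = Category C
  open HomReasoning D
  open Functor

  homomorphism₃ : (F : Functor C D) {W X Y Z : C.Obj} {f : W C.⇒ X} {g : X C.⇒ Y} {h : Y C.⇒ Z} →
                  F₁ F h ∘ F₁ F g ∘ F₁ F f ≈ F₁ F (h C.∘ g C.∘ f)
  homomorphism₃ F = ≈-trans (refl⟩∘⟨ ≈-sym (homomorphism F)) (≈-sym (homomorphism F))

  Retract-map : ∀ {X Y} (F : Functor C D) → Retract C X Y → Retract D (F₀ F X) (F₀ F Y)
  Retract-map F ρ = record
    { section    = F₁ F section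
    ; retract    = F₁ F retract
    ; is-retract = begin
        F₁ F retract ∘ F₁ F section ≈⟨ ≈-sym (homomorphism F) ⟩
        F₁ F (retract C.∘ section)  ≈⟨ F-resp-≈ F is-retract ⟩
        F₁ F C.id                   ≈⟨ identity F ⟩
        id                          ∎
    }
    where open Retract ρ

  η-retract : ∀ {X Y} {H H′ : Functor C D} (α : NaturalTransformation H H′) (ρ : Retract C X Y) →
              F₁ H′ (Retract.retract ρ) ∘ NaturalTransformation.η α Y ∘ F₁ H (Retract.section ρ)
                ≈ NaturalTransformation.η α X
  η-retract {X} {Y} {H} {H′} α ρ = begin
    F₁ H′ retract ∘ η Y ∘ F₁ H section   ≈⟨ refl⟩∘⟨ commute section ⟩
    F₁ H′ retract ∘ F₁ H′ section ∘ η X  ≈⟨ sym-assoc ⟩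
    (F₁ H′ retract ∘ F₁ H′ section) ∘ η X ≈⟨ Retract.is-retract (Retract-map H′ ρ) ⟩∘⟨refl ⟩
    id ∘ η X                             ≈⟨ identityˡ ⟩
    η X                                  ∎
    where
      open Retract ρ
      open NaturalTransformation α

  natural-iso : (K K′ : Functor C D) (φ : ∀ c → Iso D (F₀ K c) (F₀ K′ c)) →
                (∀ {c c′} (f : c C.⇒ c′) → Iso.from (φ c′) ∘ F₁ K f ≈ F₁ K′ f ∘ Iso.from (φ c)) →
                Iso (FunctorCategory C D) K K′
  natural-iso K K′ φ from-natural = record
    { from = record { η = λ c → Iso.from (φ c) ; commute = from-natural }
    ; to   = record { η = λ c → Iso.to (φ c)
                    ; commute = λ f → iso-square-inverse (φ _) (φ _) (from-natural f) }
    ; isoˡ = λ c → Iso.isoˡ (φ c)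
    ; isoʳ = λ c → Iso.isoʳ (φ c)
    }

  restricted-functors-iso :
    (K K′ : Functor C D) {Y : C.Obj → Obj} {ε : ∀ c → Y c ⇒ Y c}
    (σ : ∀ c → Splitting D (F₀ K c) (ε c)) (σ′ : ∀ c → Splitting D (F₀ K′ c) (ε c))
    (Φ : ∀ {c c′} → c C.⇒ c′ → Y c ⇒ Y c′) →
    (∀ {c c′} (f : c C.⇒ c′) → F₁ K f ≈ restrict (σ c) (σ c′) (Φ f)) →
    (∀ {c c′} (f : c C.⇒ c′) → F₁ K′ f ≈ restrict (σ′ c) (σ′ c′) (Φ f)) →
    Iso (FunctorCategory C D) K K′
  restricted-functors-iso K K′ σ σ′ Φ K-restrict K′-restrict =
    natural-iso K K′ (λ c → splitting-iso (σ c) (σ′ c)) λ {c} {c′} f → begin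
      restrict (σ c′) (σ′ c′) id ∘ F₁ K f
        ≈⟨ refl⟩∘⟨ K-restrict f ⟩
      restrict (σ c′) (σ′ c′) id ∘ restrict (σ c) (σ c′) (Φ f)
        ≈⟨ restrict-square (σ c) (σ′ c) (σ c′) (σ′ c′) (Φ f) ⟩
      restrict (σ′ c) (σ′ c′) (Φ f) ∘ restrict (σ c) (σ′ c) id
        ≈⟨ ≈-sym (K′-restrict f) ⟩∘⟨refl ⟩
      F₁ K′ f ∘ restrict (σ c) (σ′ c) id ∎

WalkingIdempotent : Category 0ℓ 0ℓ 0ℓ
WalkingIdempotent = record
  { Obj = ⊤ ; _⇒_ = λ _ _ → Bool ; _≈_ = _≡_ ; id = false ; _∘_ = _∨_
  ; equiv     = isEquivalence
  ; assoc     = λ {_} {_} {_} {_} {f} {g} {h} → ∨-assoc h g f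
  ; identityˡ = refl
  ; identityʳ = λ {_} {_} {f} → ∨-identityʳ f
  ; ∘-resp-≈  = λ { refl refl → refl }
  }

module _ {o ℓ e : Level} (D : Category o ℓ e) where
  open HomReasoning D

  cocomplete⇒idempotents-split : Cocomplete D → IdempotentsSplit D
  cocomplete⇒idempotents-split cocomplete {Y} ε ε∘ε≈ε =
    apex , record
      { retraction = record { section = rep ε-cocone ; retract = ψ tt ; is-retract = is-retract }
      ; splits     = factors ε-cocone tt
      }
    where
      diagram₁ : Bool → Y ⇒ Y
      diagram₁ false = id
      diagram₁ true  = ε

      diagram₁-∘ : (f g : Bool) → diagram₁ (g ∨ f) ≈ diagram₁ g ∘ diagram₁ f
      diagram₁-∘ false false = ≈-sym identityˡ
      diagram₁-∘ true  false = ≈-sym identityˡ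
      diagram₁-∘ false true  = ≈-sym identityʳ
      diagram₁-∘ true  true  = ≈-sym ε∘ε≈ε

      diagram : Functor WalkingIdempotent D
      diagram = record
        { F₀ = λ _ → Y ; F₁ = diagram₁ ; identity = ≈-refl
        ; homomorphism = λ {_} {_} {_} {f} {g} → diagram₁-∘ f g
        ; F-resp-≈ = λ { refl → ≈-refl } }

      open Colimit (cocomplete WalkingIdempotent diagram)

      ε-absorbs : (f : Bool) → ε ∘ diagram₁ f ≈ ε
      ε-absorbs false = identityʳ
      ε-absorbs true  = ε∘ε≈ε

      ε-cocone : Cocone D diagram
      ε-cocone = record { apex = Y ; ψ = λ _ → ε ; commute = ε-absorbs }

      -- ψ tt ∘ rep ε-cocone and id both factor ψ through itself, so they agree by uniqueness
      is-retract : ψ tt ∘ rep ε-cocone ≈ id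
      is-retract = ≈-trans (unique colim (ψ tt ∘ rep ε-cocone) λ { tt → begin
          (ψ tt ∘ rep ε-cocone) ∘ ψ tt ≈⟨ assoc ⟩
          ψ tt ∘ rep ε-cocone ∘ ψ tt   ≈⟨ refl⟩∘⟨ factors ε-cocone tt ⟩
          ψ tt ∘ ε                     ≈⟨ commute true ⟩
          ψ tt                         ∎ })
        (≈-sym (unique colim id λ { tt → identityˡ }))

module _ {oa ℓa ea ob ℓb eb : Level} {A : Category oa ℓa ea} {B : Category ob ℓb eb} where
  private
    module A = Category A
  open HomReasoning B
  open Functor

  record FullyFaithful (J : Functor A B) : Set (oa ⊔ ℓa ⊔ ea ⊔ ℓb ⊔ eb) where
    field
      preimage   : ∀ {a a′} → F₀ J a ⇒ F₀ J a′ → a A.⇒ a′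
      J-preimage : ∀ {a a′} (f : F₀ J a ⇒ F₀ J a′) → F₁ J (preimage f) ≈ f
      faithful   : ∀ {a a′} {f g : a A.⇒ a′} → F₁ J f ≈ F₁ J g → f A.≈ g

    private variable
      a a′ a″ : A.Obj

    preimage-resp-≈ : {f g : F₀ J a ⇒ F₀ J a′} → f ≈ g → preimage f A.≈ preimage g
    preimage-resp-≈ {f = f} {g} f≈g = faithful (begin
      F₁ J (preimage f) ≈⟨ J-preimage f ⟩
      f                 ≈⟨ f≈g ⟩
      g                 ≈⟨ ≈-sym (J-preimage g) ⟩
      F₁ J (preimage g) ∎)

    preimage-∘ : (f : F₀ J a ⇒ F₀ J a′) (g : F₀ J a′ ⇒ F₀ J a″) →
                 preimage g A.∘ preimage f A.≈ preimage (g ∘ f)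
    preimage-∘ f g = faithful (begin
      F₁ J (preimage g A.∘ preimage f)        ≈⟨ homomorphism J ⟩
      F₁ J (preimage g) ∘ F₁ J (preimage f)   ≈⟨ J-preimage g ⟩∘⟨ J-preimage f ⟩
      g ∘ f                                   ≈⟨ ≈-sym (J-preimage (g ∘ f)) ⟩
      F₁ J (preimage (g ∘ f))                 ∎)

    preimage-J : (f : a A.⇒ a′) → preimage (F₁ J f) A.≈ f
    preimage-J f = faithful (J-preimage (F₁ J f))

    Retract-reflect : Retract B (F₀ J a) (F₀ J a′) → Retract A a a′
    Retract-reflect ρ = record
      { section    = preimage section
      ; retract    = preimage retract
      ; is-retract = faithful (begin
          F₁ J (preimage retract A.∘ preimage section)      ≈⟨ homomorphism J ⟩
          F₁ J (preimage retract) ∘ F₁ J (preimage section) ≈⟨ J-preimage retract ⟩∘⟨ J-preimage section ⟩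
          retract ∘ section                                 ≈⟨ is-retract ⟩
          id                                                ≈⟨ ≈-sym (identity J) ⟩
          F₁ J A.id                                         ∎)
      }
      where open Retract ρ

module PrecompositionEquivalence
  {oa ℓa ea ob ℓb eb o ℓ e : Level} {A : Category oa ℓa ea} {B : Category ob ℓb eb}
  (D : Category o ℓ e) (J : Functor A B) (J-ff : FullyFaithful J)
  (cover : Category.Obj B → Category.Obj A)
  (covering : ∀ b → Retract B b (Functor.F₀ J (cover b)))
  (idempotents-split : IdempotentsSplit D)
  where

  private
    module A = Category A
    module B = HomReasoning B
    module J = Functor J
  open HomReasoning D
  open FullyFaithful J-ff
  open Functor
  open Retract

  private variable
    b b′ b″ : B.Obj

  conj : b B.⇒ b′ → J.F₀ (cover b) B.⇒ J.F₀ (cover b′)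
  conj = conjugate (covering _) (covering _)

  module _ (F : Functor A D) where

    lift : ∀ {a a′} → J.F₀ a B.⇒ J.F₀ a′ → F₀ F a ⇒ F₀ F a′
    lift f = F₁ F (preimage f)

    lift-resp-≈ : ∀ {a a′} {f g : J.F₀ a B.⇒ J.F₀ a′} → f B.≈ g → lift f ≈ lift g
    lift-resp-≈ f≈g = F-resp-≈ F (preimage-resp-≈ f≈g)

    lift-∘ : ∀ {a a′ a″} (f : J.F₀ a B.⇒ J.F₀ a′) (g : J.F₀ a′ B.⇒ J.F₀ a″) →
             lift g ∘ lift f ≈ lift (g B.∘ f)
    lift-∘ f g = ≈-trans (≈-sym (homomorphism F)) (F-resp-≈ F (preimage-∘ f g))

  lift-precomposed : (H : Functor B D) {a a′ : A.Obj} (f : J.F₀ a B.⇒ J.F₀ a′) →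
                     lift (H ∘F J) f ≈ F₁ H f
  lift-precomposed H f = F-resp-≈ H (J-preimage f)

  module Extension (F : Functor A D) where

    Φ : b B.⇒ b′ → F₀ F (cover b) ⇒ F₀ F (cover b′)
    Φ f = lift F (conj f)

    Φ-∘ : (f : b B.⇒ b′) (g : b′ B.⇒ b″) → Φ g ∘ Φ f ≈ Φ (g B.∘ f)
    Φ-∘ f g = ≈-trans (lift-∘ F (conj f) (conj g))
                      (lift-resp-≈ F (conjugate-∘ (covering _) (covering _) (covering _) f g))

    Φ-resp-≈ : {f g : b B.⇒ b′} → f B.≈ g → Φ f ≈ Φ g
    Φ-resp-≈ f≈g = lift-resp-≈ F (conjugate-resp-≈ (covering _) (covering _) f≈g)

    -- Φ preserves composition but not identities: Φ id is the idempotent that extend splits.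
    ε : ∀ b → F₀ F (cover b) ⇒ F₀ F (cover b)
    ε b = Φ (B.id {b})

    ε-absorbˡ : (f : b B.⇒ b′) → ε b′ ∘ Φ f ≈ Φ f
    ε-absorbˡ f = ≈-trans (Φ-∘ f B.id) (Φ-resp-≈ B.identityˡ)

    ε-absorbʳ : (f : b B.⇒ b′) → Φ f ∘ ε b ≈ Φ f
    ε-absorbʳ f = ≈-trans (Φ-∘ B.id f) (Φ-resp-≈ B.identityʳ)

    X : B.Obj → Obj
    X b = proj₁ (idempotents-split (ε b) (ε-absorbˡ B.id))

    σ : ∀ b → Splitting D (X b) (ε b)
    σ b = proj₂ (idempotents-split (ε b) (ε-absorbˡ B.id))

    extend : Functor B D
    extend = record
      { F₀ = X
      ; F₁ = λ f → restrict (σ _) (σ _) (Φ f)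
      ; identity = restrict-idempotent (σ _)
      ; homomorphism = λ {b} {b′} {b″} {f} {g} → ≈-sym (begin
          restrict (σ b′) (σ b″) (Φ g) ∘ restrict (σ b) (σ b′) (Φ f)
            ≈⟨ restrict-∘ (σ b) (σ b′) (σ b″) (Φ f) (Φ g) ⟩
          restrict (σ b) (σ b″) (Φ g ∘ ε b′ ∘ Φ f)
            ≈⟨ restrict-resp-≈ (σ b) (σ b″) (refl⟩∘⟨ ε-absorbˡ f) ⟩
          restrict (σ b) (σ b″) (Φ g ∘ Φ f)
            ≈⟨ restrict-resp-≈ (σ b) (σ b″) (Φ-∘ f g) ⟩
          restrict (σ b) (σ b″) (Φ (g B.∘ f)) ∎)
      ; F-resp-≈ = λ f≈g → restrict-resp-≈ (σ _) (σ _) (Φ-resp-≈ f≈g)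
      }

  open Extension using (Φ; ε; ε-absorbˡ; ε-absorbʳ; σ; extend)

  module _ {F F′ : Functor A D} (α : NaturalTransformation F F′) where
    open NaturalTransformation α

    Φ-natural : (f : b B.⇒ b′) → η (cover b′) ∘ Φ F f ≈ Φ F′ f ∘ η (cover b)
    Φ-natural f = commute (preimage (conj f))

    extend₁ : NaturalTransformation (extend F) (extend F′)
    extend₁ = record
      { η = λ b → restrict (σ F b) (σ F′ b) (η (cover b))
      ; commute = λ {b} {b′} f → begin
          restrict (σ F b′) (σ F′ b′) (η (cover b′)) ∘ restrict (σ F b) (σ F b′) (Φ F f)
            ≈⟨ restrict-∘ (σ F b) (σ F b′) (σ F′ b′) (Φ F f) (η (cover b′)) ⟩
          restrict (σ F b) (σ F′ b′) (η (cover b′) ∘ ε F b′ ∘ Φ F f)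
            ≈⟨ restrict-resp-≈ (σ F b) (σ F′ b′) (refl⟩∘⟨ ε-absorbˡ F f) ⟩
          restrict (σ F b) (σ F′ b′) (η (cover b′) ∘ Φ F f)
            ≈⟨ restrict-resp-≈ (σ F b) (σ F′ b′) (Φ-natural f) ⟩
          restrict (σ F b) (σ F′ b′) (Φ F′ f ∘ η (cover b))
            ≈⟨ restrict-resp-≈ (σ F b) (σ F′ b′) (≈-sym (ε-absorbʳ F′ f) ⟩∘⟨refl) ⟩
          restrict (σ F b) (σ F′ b′) ((Φ F′ f ∘ ε F′ b) ∘ η (cover b))
            ≈⟨ restrict-resp-≈ (σ F b) (σ F′ b′) assoc ⟩
          restrict (σ F b) (σ F′ b′) (Φ F′ f ∘ ε F′ b ∘ η (cover b))
            ≈⟨ ≈-sym (restrict-∘ (σ F b) (σ F′ b) (σ F′ b′) (η (cover b)) (Φ F′ f)) ⟩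
          restrict (σ F′ b) (σ F′ b′) (Φ F′ f) ∘ restrict (σ F b) (σ F′ b) (η (cover b)) ∎
      }

  extend₁-∘ : {F F′ F″ : Functor A D}
              (α : NaturalTransformation F F′) (β : NaturalTransformation F′ F″) (b : B.Obj) →
              let open NaturalTransformation in
              restrict (σ F b) (σ F″ b) (η β (cover b) ∘ η α (cover b))
                ≈ restrict (σ F′ b) (σ F″ b) (η β (cover b)) ∘ restrict (σ F b) (σ F′ b) (η α (cover b))
  extend₁-∘ {F} {F′} {F″} α β b = ≈-sym (begin
    restrict (σ F′ b) (σ F″ b) β₁ ∘ restrict (σ F b) (σ F′ b) α₁
      ≈⟨ restrict-∘ (σ F b) (σ F′ b) (σ F″ b) α₁ β₁ ⟩
    restrict (σ F b) (σ F″ b) (β₁ ∘ ε F′ b ∘ α₁)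
      ≈⟨ restrict-resp-≈ (σ F b) (σ F″ b) (refl⟩∘⟨ ≈-sym (Φ-natural α B.id)) ⟩
    restrict (σ F b) (σ F″ b) (β₁ ∘ α₁ ∘ ε F b)
      ≈⟨ restrict-resp-≈ (σ F b) (σ F″ b) sym-assoc ⟩
    restrict (σ F b) (σ F″ b) ((β₁ ∘ α₁) ∘ ε F b)
      ≈⟨ restrict-absorbʳ (σ F b) (σ F″ b) (β₁ ∘ α₁) ⟩
    restrict (σ F b) (σ F″ b) (β₁ ∘ α₁) ∎)
    where
      α₁ = NaturalTransformation.η α (cover b)
      β₁ = NaturalTransformation.η β (cover b)

  extension : Functor (FunctorCategory A D) (FunctorCategory B D)
  extension = record
    { F₀ = extend
    ; F₁ = extend₁
    ; identity = λ {F} b → restrict-id (σ F b)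
    ; homomorphism = λ {_} {_} {_} {α} {β} → extend₁-∘ α β
    ; F-resp-≈ = λ {F} {F′} α≈β b → restrict-resp-≈ (σ F b) (σ F′ b) (α≈β (cover b))
    }

  module _ (H : Functor B D) where

    image-splitting : ∀ b → Splitting D (F₀ H b) (ε (H ∘F J) b)
    image-splitting b = record
      { retraction = Retract-map H ρ
      ; splits     = begin
          F₁ H (section ρ) ∘ F₁ H (retract ρ) ≈⟨ ≈-sym (homomorphism H) ⟩
          F₁ H (section ρ B.∘ retract ρ)      ≈⟨ F-resp-≈ H (B.≈-sym (conjugate-id ρ)) ⟩
          F₁ H (conj B.id)                    ≈⟨ ≈-sym (lift-precomposed H (conj B.id)) ⟩
          ε (H ∘F J) b                        ∎
      }
      where ρ = covering b

    image-splitting-restrict : (f : b B.⇒ b′) →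
      F₁ H f ≈ restrict (image-splitting b) (image-splitting b′) (Φ (H ∘F J) f)
    image-splitting-restrict {b} {b′} f = ≈-sym (begin
      F₁ H (retract ρ′) ∘ lift (H ∘F J) (conj f) ∘ F₁ H (section ρ) ≈⟨ refl⟩∘⟨ lift-precomposed H (conj f) ⟩∘⟨refl ⟩
      F₁ H (retract ρ′) ∘ F₁ H (conj f) ∘ F₁ H (section ρ)          ≈⟨ homomorphism₃ H ⟩
      F₁ H (retract ρ′ B.∘ conj f B.∘ section ρ)                    ≈⟨ F-resp-≈ H (retract-conjugate ρ ρ′ f) ⟩
      F₁ H f                                                        ∎)
      where
        ρ  = covering b
        ρ′ = covering b′

    extend-precomposed≅ : Iso (FunctorCategory B D) (extend (H ∘F J)) H
    extend-precomposed≅ = restricted-functors-iso (extend (H ∘F J)) H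
      (σ (H ∘F J)) image-splitting (Φ (H ∘F J)) (λ _ → ≈-refl) image-splitting-restrict

  extension∘precompose≅id :
    Iso (FunctorCategory (FunctorCategory B D) (FunctorCategory B D)) (extension ∘F precompose D J) idF
  extension∘precompose≅id = natural-iso _ _ extend-precomposed≅ λ {H} {H′} α b →
    ≈-trans (restrict-square (σ (H ∘F J) b) (image-splitting H b) (σ (H′ ∘F J) b) (image-splitting H′ b) _)
            (η-retract α (covering b) ⟩∘⟨refl)

  module _ (F : Functor A D) where

    reflected-splitting : ∀ a → Splitting D (F₀ F a) (ε F (J.F₀ a))
    reflected-splitting a = record
      { retraction = Retract-map F (Retract-reflect ρ)
      ; splits     = begin
          lift F (section ρ) ∘ lift F (retract ρ) ≈⟨ lift-∘ F _ _ ⟩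
          lift F (section ρ B.∘ retract ρ)        ≈⟨ lift-resp-≈ F (B.≈-sym (conjugate-id ρ)) ⟩
          ε F (J.F₀ a)                            ∎
      }
      where ρ = covering (J.F₀ a)

    reflected-splitting-restrict : ∀ {a a′} (f : a A.⇒ a′) →
      F₁ F f ≈ restrict (reflected-splitting a) (reflected-splitting a′) (Φ F (J.F₁ f))
    reflected-splitting-restrict {a} {a′} f = ≈-sym (begin
      lift F (retract ρ′) ∘ lift F (conj (J.F₁ f)) ∘ lift F (section ρ) ≈⟨ refl⟩∘⟨ lift-∘ F _ _ ⟩
      lift F (retract ρ′) ∘ lift F (conj (J.F₁ f) B.∘ section ρ)        ≈⟨ lift-∘ F _ _ ⟩
      lift F (retract ρ′ B.∘ conj (J.F₁ f) B.∘ section ρ)               ≈⟨ lift-resp-≈ F (retract-conjugate ρ ρ′ (J.F₁ f)) ⟩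
      lift F (J.F₁ f)                                                   ≈⟨ F-resp-≈ F (preimage-J f) ⟩
      F₁ F f                                                            ∎)
      where
        ρ  = covering (J.F₀ a)
        ρ′ = covering (J.F₀ a′)

    extension-precomposed≅ : Iso (FunctorCategory A D) (extend F ∘F J) F
    extension-precomposed≅ = restricted-functors-iso (extend F ∘F J) F
      (λ a → σ F (J.F₀ a)) reflected-splitting (λ f → Φ F (J.F₁ f)) (λ _ → ≈-refl)
      reflected-splitting-restrict

  precompose∘extension≅id :
    Iso (FunctorCategory (FunctorCategory A D) (FunctorCategory A D)) (precompose D J ∘F extension) idF
  precompose∘extension≅id = natural-iso _ _ extension-precomposed≅ λ {F} {F′} α a →
    ≈-trans (restrict-square (σ F (J.F₀ a)) (reflected-splitting F a)
                             (σ F′ (J.F₀ a)) (reflected-splitting F′ a) _)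
            (η-retract α (Retract-reflect (covering (J.F₀ a))) ⟩∘⟨refl)

  precompose-isEquivalence : IsEquivalenceOfCategories (precompose D J)
  precompose-isEquivalence = extension , extension∘precompose≅id , precompose∘extension≅id

module LambdaCalculus (Λ : LambdaTheory) where
  open LambdaTheory Λ
  open ≡-Reasoning

  private variable
    m n : ℕ

  vars-• : (h : Vec (T n) m) → map (_• h) (tabulate var) ≡ h
  vars-• h = begin
    map (_• h) (tabulate var)       ≡⟨ tabulate-∘ (_• h) var ⟨
    tabulate (λ i → var i • h)      ≡⟨ tabulate-cong (λ i → var-• i h) ⟩
    tabulate (lookup h)             ≡⟨ tabulate∘lookup h ⟩
    h                               ∎

  snoc : T n → Vec (T n) (n + 1)
  snoc a = tabulate var ++ a ∷ []

  ι-•-snoc : (t : T n) (a : T n) → ι n 1 t • snoc a ≡ t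
  ι-•-snoc {n} t a = begin
    (t • tabulate (λ i → var (i ↑ˡ 1))) • snoc a        ≡⟨ •-assoc t _ (snoc a) ⟩
    t • map (_• snoc a) (tabulate (λ i → var (i ↑ˡ 1))) ≡⟨ cong (t •_) (tabulate-∘ _ _) ⟨
    t • tabulate (λ i → var (i ↑ˡ 1) • snoc a)          ≡⟨ cong (t •_) (tabulate-cong weakened-var) ⟩
    t • tabulate var                                    ≡⟨ •-var t ⟩
    t                                                   ∎
    where
      weakened-var : (i : Fin n) → var (i ↑ˡ 1) • snoc a ≡ var i
      weakened-var i = begin
        var (i ↑ˡ 1) • snoc a          ≡⟨ var-• _ (snoc a) ⟩
        lookup (snoc a) (i ↑ˡ 1)       ≡⟨ lookup-++ˡ (tabulate var) (a ∷ []) i ⟩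
        lookup (tabulate var) i        ≡⟨ lookup∘tabulate var i ⟩
        var i                          ∎

  ext-•-snoc : (h : Vec (T n) m) (a : T n) → map (_• snoc a) (ext h) ≡ h ++ a ∷ []
  ext-•-snoc {n} h a = begin
    map (_• snoc a) (map (ι n 1) h ++ var (n ↑ʳ zero) ∷ [])
      ≡⟨ map-++ _ (map (ι n 1) h) _ ⟩
    map (_• snoc a) (map (ι n 1) h) ++ (var (n ↑ʳ zero) • snoc a) ∷ []
      ≡⟨ cong₂ _++_ weakened (cong (_∷ []) last) ⟩
    h ++ a ∷ [] ∎
    where
      weakened : map (_• snoc a) (map (ι n 1) h) ≡ h
      weakened = trans (sym (map-∘ _ _ h)) (trans (map-cong (λ t → ι-•-snoc t a) h) (map-id h))
      last : var (n ↑ʳ zero) • snoc a ≡ a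
      last = trans (var-• _ (snoc a)) (lookup-++ʳ (tabulate var) (a ∷ []) zero)

  app : T n → T n → T n
  app f a = rho f • snoc a

  app-lam : (f : T (n + 1)) (a : T n) → app (lam f) a ≡ f • snoc a
  app-lam f a = cong (_• snoc a) (rho-lam f)

  app-• : (f a : T m) (h : Vec (T n) m) → app f a • h ≡ app (f • h) (a • h)
  app-• f a h = begin
    (rho f • snoc a) • h                        ≡⟨ •-assoc (rho f) (snoc a) h ⟩
    rho f • map (_• h) (snoc a)                 ≡⟨ cong (rho f •_) (map-++ _ (tabulate var) (a ∷ [])) ⟩
    rho f • (map (_• h) (tabulate var) ++ (a • h) ∷ [])
                                                ≡⟨ cong (λ v → rho f • (v ++ (a • h) ∷ [])) (vars-• h) ⟩
    rho f • (h ++ (a • h) ∷ [])                 ≡⟨ cong (rho f •_) (ext-•-snoc h (a • h)) ⟨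
    rho f • map (_• snoc (a • h)) (ext h)       ≡⟨ •-assoc (rho f) (ext h) (snoc (a • h)) ⟨
    (rho f • ext h) • snoc (a • h)              ≡⟨ cong (_• snoc (a • h)) (rho-subst f h) ⟨
    app (f • h) (a • h)                         ∎

  app₂-lam² : (t : T (n + 1 + 1)) (a b : T n) → app (app (lam (lam t)) a) b ≡ t • (snoc a ++ b ∷ [])
  app₂-lam² t a b = begin
    app (app (lam (lam t)) a) b              ≡⟨ cong (λ f → app f b) (app-lam (lam t) a) ⟩
    app (lam t • snoc a) b                   ≡⟨ cong (λ f → app f b) (lam-subst t (snoc a)) ⟩
    app (lam (t • ext (snoc a))) b           ≡⟨ app-lam _ b ⟩
    (t • ext (snoc a)) • snoc b              ≡⟨ •-assoc t (ext (snoc a)) (snoc b) ⟩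
    t • map (_• snoc b) (ext (snoc a))       ≡⟨ cong (t •_) (ext-•-snoc (snoc a) b) ⟩
    t • (snoc a ++ b ∷ [])                   ∎

  lam²-• : (t : T (m + 1 + 1)) (h : Vec (T n) m) → lam (lam t) • h ≡ lam (lam (t • ext (ext h)))
  lam²-• t h = trans (lam-subst (lam t) h) (cong lam (lam-subst t (ext h)))

  x₀ x₁ : T 2
  x₀ = var zero
  x₁ = var (suc zero)

  -- ⟨x₀, x₁⟩ = λz. z x₀ x₁, fst p = p (λa b. a), snd p = p (λa b. b); note that lam binds
  -- the last variable, e.g. var 2 is z in the body of pair.
  pair : T 2
  pair = lam (app (app (var (suc (suc zero))) (var zero)) (var (suc zero)))

  fst snd : T 1
  fst = app (var zero) (lam (lam (var (suc zero))))
  snd = app (var zero) (lam (lam (var (suc (suc zero)))))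

  app-pair : (k : T 2) → app pair k ≡ app (app k x₀) x₁
  app-pair k = begin
    app pair k
      ≡⟨ app-lam _ k ⟩
    app (app (var (suc (suc zero))) (var zero)) (var (suc zero)) • snoc k
      ≡⟨ app-• _ _ (snoc k) ⟩
    app (app (var (suc (suc zero))) (var zero) • snoc k) (var (suc zero) • snoc k)
      ≡⟨ cong₂ app (app-• _ _ (snoc k)) (var-• _ (snoc k)) ⟩
    app (app (var (suc (suc zero)) • snoc k) (var zero • snoc k)) x₁
      ≡⟨ cong (λ f → app f x₁) (cong₂ app (var-• _ (snoc k)) (var-• _ (snoc k))) ⟩
    app (app k x₀) x₁ ∎

  fst-pair : fst • (pair ∷ []) ≡ x₀
  fst-pair = begin
    fst • (pair ∷ [])
      ≡⟨ app-• _ _ (pair ∷ []) ⟩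
    app (var zero • (pair ∷ [])) (lam (lam (var (suc zero))) • (pair ∷ []))
      ≡⟨ cong₂ app (var-• zero (pair ∷ [])) (lam²-• _ (pair ∷ [])) ⟩
    app pair (lam (lam (var (suc zero) • ext (ext (pair ∷ [])))))
      ≡⟨ cong (λ t → app pair (lam (lam t))) (trans (var-• _ _) (var-• _ _)) ⟩
    app pair (lam (lam (var (suc (suc zero)))))
      ≡⟨ app-pair _ ⟩
    app (app (lam (lam (var (suc (suc zero))))) x₀) x₁
      ≡⟨ app₂-lam² _ x₀ x₁ ⟩
    var (suc (suc zero)) • (snoc x₀ ++ x₁ ∷ [])
      ≡⟨ var-• _ _ ⟩
    x₀ ∎

  snd-pair : snd • (pair ∷ []) ≡ x₁
  snd-pair = begin
    snd • (pair ∷ [])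
      ≡⟨ app-• _ _ (pair ∷ []) ⟩
    app (var zero • (pair ∷ [])) (lam (lam (var (suc (suc zero)))) • (pair ∷ []))
      ≡⟨ cong₂ app (var-• zero (pair ∷ [])) (lam²-• _ (pair ∷ [])) ⟩
    app pair (lam (lam (var (suc (suc zero)) • ext (ext (pair ∷ [])))))
      ≡⟨ cong (λ t → app pair (lam (lam t))) (var-• _ _) ⟩
    app pair (lam (lam (var (suc (suc (suc zero))))))
      ≡⟨ app-pair _ ⟩
    app (app (lam (lam (var (suc (suc (suc zero)))))) x₀) x₁
      ≡⟨ app₂-lam² _ x₀ x₁ ⟩
    var (suc (suc (suc zero))) • (snoc x₀ ++ x₁ ∷ [])
      ≡⟨ var-• _ _ ⟩
    x₁ ∎

  fst-• : (a b : T n) → fst • (pair • (a ∷ b ∷ []) ∷ []) ≡ a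
  fst-• a b = trans (sym (•-assoc fst (pair ∷ []) (a ∷ b ∷ [])))
                    (trans (cong (_• (a ∷ b ∷ [])) fst-pair) (var-• zero (a ∷ b ∷ [])))

  snd-• : (a b : T n) → snd • (pair • (a ∷ b ∷ []) ∷ []) ≡ b
  snd-• a b = trans (sym (•-assoc snd (pair ∷ []) (a ∷ b ∷ [])))
                    (trans (cong (_• (a ∷ b ∷ [])) snd-pair) (var-• (suc zero) (a ∷ b ∷ [])))

  -- encode n = ⟨x₀, ⟨x₁, … ⟨xₙ₋₁, λx.x⟩ …⟩⟩; the innermost closed term is arbitrary.
  encode : ∀ n → T n
  encode zero    = lam (var zero)
  encode (suc n) = pair • (var zero ∷ encode n • tabulate (λ i → var (suc i)) ∷ [])

  decode : ∀ n → Vec (T 1) n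
  decode zero    = []
  decode (suc n) = fst ∷ map (_• (snd ∷ [])) (decode n)

  decode-encode : ∀ n → map (_• (encode n ∷ [])) (decode n) ≡ tabulate var
  decode-encode zero    = refl
  decode-encode (suc n) = cong₂ _∷_ (fst-• _ _) (begin
    map (_• (encode (suc n) ∷ [])) (map (_• (snd ∷ [])) (decode n))
      ≡⟨ map-∘ _ _ (decode n) ⟨
    map (λ t → (t • (snd ∷ [])) • (encode (suc n) ∷ [])) (decode n)
      ≡⟨ map-cong (λ t → •-assoc t (snd ∷ []) _) (decode n) ⟩
    map (λ t → t • (snd • (encode (suc n) ∷ []) ∷ [])) (decode n)
      ≡⟨ map-cong (λ t → cong (λ u → t • (u ∷ [])) (snd-• _ _)) (decode n) ⟩
    map (λ t → t • (encode n • shift ∷ [])) (decode n)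
      ≡⟨ map-cong (λ t → •-assoc t (encode n ∷ []) shift) (decode n) ⟨
    map (λ t → (t • (encode n ∷ [])) • shift) (decode n)
      ≡⟨ map-∘ _ _ (decode n) ⟩
    map (_• shift) (map (_• (encode n ∷ [])) (decode n))
      ≡⟨ cong (map (_• shift)) (decode-encode n) ⟩
    map (_• shift) (tabulate var)
      ≡⟨ vars-• shift ⟩
    shift ∎)
    where
      shift : Vec (T (suc n)) n
      shift = tabulate (λ i → var (suc i))

module _ (Λ : LambdaTheory) where
  open LambdaCalculus Λ

  embedding-fullyFaithful : FullyFaithful (embedding Λ)
  embedding-fullyFaithful = record
    { preimage   = λ { (t ∷ []) → t }
    ; J-preimage = λ { (t ∷ []) → refl }
    ; faithful   = λ { refl → refl }
    }

  tuple-retract : ∀ n → Retract (Lawvere Λ) n 1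
  tuple-retract n = record
    { section    = encode n ∷ []
    ; retract    = decode n
    ; is-retract = decode-encode n
    }

proposition49 : (Λ : LambdaTheory) {o ℓ e : Level} (D : Category o ℓ e) →
                Cocomplete D →
                IsEquivalenceOfCategories (precompose D (embedding Λ))
proposition49 Λ D cocomplete =
  precompose-isEquivalence D (embedding Λ) (embedding-fullyFaithful Λ) (λ _ → tt) (tuple-retract Λ)
    (cocomplete⇒idempotents-split D cocomplete)
  where open PrecompositionEquivalence
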